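{- The BVU problem with $m=2$ candidates is equivalent to the KU problem, in the following sense. Given a BVU instance with $m=2$ (candidates $c_1,c_2$, voter sets $V_1,V_2$, $r=|V_1|-|V_2|$, prices $q_i$, probabilities $p_i$, budget $Q$), consider the KU instance whose items are the voters $v_i\in V_1$, with size $q_i$, profit $P_i$ satisfying $\Pr(P_i=1)=p_i$, $\Pr(P_i=0)=1-p_i$, capacity $Q$ and the same integer $r$. Then for every index set $I$ of voters in $V_1$ with $\sum_{i\in I}q_i\le Q$, the probability that $c_2$ wins when the voters in $I$ are bribed equals $\Pr\left(\sum_{i\in I}P_i\ge r+1-|I|\right)$; consequently the two problems have the same feasible solutions and the same objective values.
   Context: BVU problem: candidates $c_1,\dots,c_m$; voters partitioned as $V_1\cup\dots\cup V_m$ where $V_j$ is the set of voters voting for $c_j$ without bribery, $|V_1|>|V_j|$ for $j>1$, designated candidate $c_m$, $r=|V_1|-|V_m|$. Each voter $v_i$ has price $q_i$ and probability $p_i\in[0,1]$; budget $Q$. The briber chooses $I$ with $\sum_{i\in I}q_i\le Q$ and bribes the voters $v_i\in V\setminus V_m$ with $i\in I$. Independently, a bribed voter's vote goes to $c_m$ and is counted with probability $p_i$, and otherwise is not counted at all; unbribed voters vote as originally. $c_m$ wins if it receives strictly more counted votes than every other candidate; the objective is the winning probability of $c_m$. KU problem (Knapsack with Uncertainty): a knapsack of capacity $Q$, items $i$ with size $q_i$ and independent random profit $P_i\in\{0,1\}$ with $\Pr(P_i=1)=p_i$, and a positive integer $r$; find $I$ with $\sum_{i\in I}q_i\le Q$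 maximizing $\Pr\left(\sum_{i\in I}P_i\ge r+1-|I|\right)$. -}

module Defs where

open import Level using (Level)
open import Data.Bool using (Bool; true; false; if_then_else_; _∧_; not)
open import Data.Nat as ℕ using (ℕ; zero; suc; _+_; _∸_; _<_; _≤_)
open import Data.Integer as ℤ using (ℤ; +_)
open import Data.Vec using (Vec; []; _∷_)
open import Data.List using (List; []; _∷_; [_]; map; _++_)
open import Data.Fin.Subset using (Subset; ∣_∣)
open import Relation.Nullary.Decidable using (⌊_⌋)
open import Algebra.Bundles using (CommutativeRing)

-- Voters of V₁ are indexed by Fin n₁; an index set I ⊆ V₁ is a Subset n₁.
-- An outcome ω : Vec Bool n₁ records, for each voter i of V₁, the result
-- of its independent Bernoulli(p_i) coin (true = "counted for c₂" / P_i = 1).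

outcomes : (n : ℕ) → List (Vec Bool n)
outcomes zero    = [ [] ]
outcomes (suc n) = map (true ∷_) (outcomes n) ++ map (false ∷_) (outcomes n)

countOn : ∀ {n} → Subset n → Vec Bool n → ℕ
countOn []      []      = 0
countOn (b ∷ I) (w ∷ ω) = (if b ∧ w then 1 else 0) + countOn I ω

unbribed : ∀ {n} → Subset n → ℕ
unbribed []      = 0
unbribed (b ∷ I) = (if b then 0 else 1) + unbribed I

cost : ∀ {n} → Subset n → Vec ℕ n → ℕ
cost []      []      = 0
cost (b ∷ I) (q ∷ qs) = (if b then q else 0) + cost I qs

-- BVU with m = 2: |V₁| = n₁, |V₂| = n₂.  Bribing I ⊆ V₁: unbribed voters of
-- V₁ vote c₁, voters of V₂ vote c₂, a bribed voter i is counted for c₂ iff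
-- its coin is true and is not counted otherwise.
votesC₁ : ∀ {n₁} → Subset n₁ → Vec Bool n₁ → ℕ
votesC₁ I ω = unbribed I

votesC₂ : ∀ {n₁} → (n₂ : ℕ) → Subset n₁ → Vec Bool n₁ → ℕ
votesC₂ n₂ I ω = n₂ + countOn I ω

c₂Wins : ∀ {n₁} → (n₂ : ℕ) → Subset n₁ → Vec Bool n₁ → Bool
c₂Wins n₂ I ω = ⌊ votesC₁ I ω ℕ.<? votesC₂ n₂ I ω ⌋

kuEvent : ∀ {n} → (r : ℕ) → Subset n → Vec Bool n → Bool
kuEvent r I ω = ⌊ (+ r ℤ.+ + 1) ℤ.- + ∣ I ∣ ℤ.≤? + countOn I ω ⌋

-- Probability of an event under independent Bernoulli(p_i) coins, with
-- probabilities taken in a commutative ring R.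
module Prob {c ℓ : Level} (R : CommutativeRing c ℓ) where
  open CommutativeRing R using (Carrier; 0#; 1#) renaming (_+_ to _⊕_; _*_ to _⊛_; _-_ to _⊖_)

  sumR : List Carrier → Carrier
  sumR []       = 0#
  sumR (x ∷ xs) = x ⊕ sumR xs

  weight : ∀ {n} → Vec Carrier n → Vec Bool n → Carrier
  weight []       []      = 1#
  weight (p ∷ ps) (w ∷ ω) = (if w then p else (1# ⊖ p)) ⊛ weight ps ω

  Pr : ∀ {n} → Vec Carrier n → (Vec Bool n → Bool) → Carrier
  Pr {n} p E = sumR (map (λ ω → if E ω then weight p ω else 0#) (outcomes n))

-- So c₂ wins iff
-- n₁ − |I| < n₂ + Σ P_i, i.e. iff Σ P_i ≥ r + 1 − |I| with r = n₁ − n₂: the two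
-- events coincide outcome by outcome, hence have the same probability.
module Submission where

open import Defs
open import Algebra.Bundles using (CommutativeRing; AbelianGroup)
open import Data.Bool using (Bool; true; false; if_then_else_)
open import Data.Fin.Subset using (Subset; ∣_∣)
import Data.Integer as ℤ
import Data.Integer.Properties as ℤ
open import Data.List.Properties using (map-cong)
open import Data.Nat using (ℕ; suc; _+_; _<_; _≤_; _∸_)
open import Data.Nat.Properties
  using (+-suc; +-comm; +-assoc; +-monoˡ-≤; +-monoʳ-≤; +-cancelˡ-≤; +-cancelʳ-≤; m+[n∸m]≡n; <⇒≤)
open import Data.Vec using (Vec; []; _∷_)
open import Function using (_⇔_; mk⇔)
open import Function.Construct.Composition using (_⇔-∘_)
open import Relation.Nullary.Decidable using (Dec; ⌊_⌋; isYes≗does; does-⇔)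
open import Relation.Binary.PropositionalEquality
  using (_≡_; _≗_; refl; sym; trans; cong; subst; subst₂; module ≡-Reasoning)
open import Algebra.Properties.Group (AbelianGroup.group ℤ.+-0-abelianGroup)
  using (//-rightDividesˡ; //-rightDividesʳ)

unbribed+∣I∣≡n : ∀ {n} (I : Subset n) → unbribed I + ∣ I ∣ ≡ n
unbribed+∣I∣≡n []          = refl
unbribed+∣I∣≡n (true ∷ I)  = trans (+-suc (unbribed I) ∣ I ∣) (cong suc (unbribed+∣I∣≡n I))
unbribed+∣I∣≡n (false ∷ I) = cong suc (unbribed+∣I∣≡n I)

⌊⌋-⇔ : ∀ {a b} {A : Set a} {B : Set b} → A ⇔ B → (a? : Dec A) (b? : Dec B) → ⌊ a? ⌋ ≡ ⌊ b? ⌋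
⌊⌋-⇔ A⇔B a? b? = trans (isYes≗does a?) (trans (does-⇔ A⇔B a? b?) (sym (isYes≗does b?)))

m≤n⇔+m≤+n : ∀ {m n} → m ≤ n ⇔ ℤ.+ m ℤ.≤ ℤ.+ n
m≤n⇔+m≤+n = mk⇔ ℤ.+≤+ ℤ.drop‿+≤+

i≤j+k⇔i-k≤j : ∀ i j k → i ℤ.≤ j ℤ.+ k ⇔ i ℤ.- k ℤ.≤ j
i≤j+k⇔i-k≤j i j k = mk⇔
  (λ i≤j+k → subst (i ℤ.- k ℤ.≤_) (//-rightDividesʳ k j) (ℤ.+-monoˡ-≤ (ℤ.- k) i≤j+k))
  (λ i-k≤j → subst (ℤ._≤ j ℤ.+ k) (//-rightDividesˡ k i) (ℤ.+-monoˡ-≤ k i-k≤j))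

u<a+c⇔b+1≤c+k : ∀ {a b c u k} → a + b ≡ u + k → u < a + c ⇔ b + 1 ≤ c + k
u<a+c⇔b+1≤c+k {a} {b} {c} {u} {k} a+b≡u+k = mk⇔
  (λ u<a+c → +-cancelˡ-≤ a _ _ (subst₂ _≤_ suc-u+k≡a+[b+1] (+-assoc a c k) (+-monoˡ-≤ k u<a+c)))
  (λ b+1≤c+k → +-cancelʳ-≤ k _ _
    (subst₂ _≤_ (sym suc-u+k≡a+[b+1]) (sym (+-assoc a c k)) (+-monoʳ-≤ a b+1≤c+k)))
  where
  open ≡-Reasoning
  suc-u+k≡a+[b+1] : suc u + k ≡ a + (b + 1)
  suc-u+k≡a+[b+1] = begin
    suc (u + k)  ≡⟨ cong suc a+b≡u+k ⟨
    suc (a + b)  ≡⟨ +-suc a b ⟨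
    a + suc b    ≡⟨ cong (a +_) (+-comm 1 b) ⟩
    a + (b + 1)  ∎

c₂Wins≗kuEvent : ∀ {n₁ n₂} → n₂ < n₁ → (I : Subset n₁) → c₂Wins n₂ I ≗ kuEvent (n₁ ∸ n₂) I
c₂Wins≗kuEvent {n₁} {n₂} n₂<n₁ I ω =
  ⌊⌋-⇔ (i≤j+k⇔i-k≤j (ℤ.+ (r + 1)) (ℤ.+ countOn I ω) (ℤ.+ ∣ I ∣)
        ⇔-∘ (m≤n⇔+m≤+n ⇔-∘ u<a+c⇔b+1≤c+k {a = n₂} {b = r} {c = countOn I ω} n₂+r≡unbribed+∣I∣))
       _ _
  where
  r : ℕ
  r = n₁ ∸ n₂

  n₂+r≡unbribed+∣I∣ : n₂ + r ≡ unbribed I + ∣ I ∣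
  n₂+r≡unbribed+∣I∣ = trans (m+[n∸m]≡n (<⇒≤ n₂<n₁)) (sym (unbribed+∣I∣≡n I))

module _ {c ℓ} (R : CommutativeRing c ℓ) where
  open CommutativeRing R using (Carrier; 0#; _≈_; reflexive)
  open Prob R

  Pr-cong : ∀ {n} (p : Vec Carrier n) {E F : Vec Bool n → Bool} → E ≗ F → Pr p E ≈ Pr p F
  Pr-cong {n} p {E} {F} E≗F = reflexive (cong sumR (map-cong weightIf-cong (outcomes n)))
    where
    weightIf-cong : ∀ ω → (if E ω then weight p ω else 0#) ≡ (if F ω then weight p ω else 0#)
    weightIf-cong ω = cong (if_then weight p ω else 0#) (E≗F ω)

lemma1 : ∀ {c ℓ} (R : CommutativeRing c ℓ) (n₁ n₂ : ℕ) → n₂ < n₁ →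
         (q : Vec ℕ n₁) (p : Vec (CommutativeRing.Carrier R) n₁) (Q : ℕ) →
         (I : Subset n₁) → cost I q ≤ Q →
         CommutativeRing._≈_ R
           (Prob.Pr R p (c₂Wins n₂ I))
           (Prob.Pr R p (kuEvent (n₁ ∸ n₂) I))
lemma1 R n₁ n₂ n₂<n₁ q p Q I _ = Pr-cong R p (c₂Wins≗kuEvent n₂<n₁ I)
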